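{- Let $n \ge 1$ and let $\sigma = [\sigma_1,\dots,\sigma_n]$ be a permutation of $\{2,\dots,n+1\}$ with inversion sequence $\mathsf{Inv}(\sigma) = (a_1,\dots,a_n)$. Then the number of maximal chains $\mathcal{F}$ in $\Pi_n$ whose max-of-min label sequence $\lambda_\mathcal{F}$ equals $\sigma$ is $a_1 \cdot a_2 \cdots a_n$.
   Context: $\Pi_n$ is the lattice of set partitions of $\{1,\dots,n+1\}$, ordered so that covers $\mathbf{B} \prec \mathbf{B}'$ are given by merging two blocks $B, B'$ of $\mathbf{B}$; its minimum is the partition into singletons and its maximum is the one-block partition. The max-of-min labeling assigns to such a cover the label $\max\{\min B, \min B'\}$. For a maximal chain $\mathcal{F} = \{\mathcal{F}_0 \prec \dots \prec \mathcal{F}_n\}$, $\lambda_\mathcal{F} = (\lambda_1,\dots,\lambda_n)$ with $\lambda_i$ the label of $\mathcal{F}_{i-1} \prec \mathcal{F}_i$; this is always a permutation of $\{2,\dots,n+1\}$. The inversion sequence of a permutation $\sigma = [\sigma_1,\dots,\sigma_n]$ of $\{2,\dots,n+1\}$ (one-line notation) is $\mathsf{Inv}(\sigma) = (a_1,\dots,a_n)$ with $a_i = \#\{ j \geq i \mid \sigma_j \le \sigma_i\}$. -}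

module Defs where

open import Data.Nat using (ℕ; zero; suc; _≤ᵇ_)
open import Data.Fin using (Fin; toℕ; _<_; _≟_)
import Data.Fin as F
open import Data.Vec using (Vec; lookup; map; tabulate; replicate)
open import Data.List using (List; []; _∷_; length; filter)
import Data.List as L
open import Data.Bool using (if_then_else_)
open import Relation.Nullary using (does)
open import Relation.Binary.PropositionalEquality using (_≡_)
open import Data.Product using (Σ)
open import Data.Nat.Properties using (_≤?_)

-- Element k ∈ {1,…,m} is encoded by the
-- index (k-1) : Fin m.  A partition is encoded canonically by the vector
-- r : Vec (Fin m) m sending each element to the minimum of its block
-- (so the blocks are the fibres of r, and the block minima are exactly
-- the fixed points of r).

SetPartition : ℕ → Set
SetPartition m = Vec (Fin m) m

bottom : (m : ℕ) → SetPartition m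
bottom m = tabulate (λ i → i)

top : (m : ℕ) → SetPartition (suc m)
top m = replicate (suc m) F.zero

merge : ∀ {m} → SetPartition m → Fin m → Fin m → SetPartition m
merge P a b = map (λ x → if does (x ≟ b) then a else x) P

data Chain {m : ℕ} : SetPartition m → SetPartition m → Set where
  done : ∀ {P} → Chain P P
  step : ∀ {P R} (Q : SetPartition m) (a b : Fin m) → a < b →
         lookup P a ≡ a → lookup P b ≡ b → Q ≡ merge P a b →
         Chain Q R → Chain P R

-- Maximal chains of Π_n (partitions of {1,…,n+1}).
MaxChain : ℕ → Set
MaxChain n = Chain (bottom (suc n)) (top n)

-- Max-of-min labelling: the cover merging blocks with minima a < b
-- (as elements: toℕ a + 1 < toℕ b + 1) has label max{min B, min B'}
-- = toℕ b + 1.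
labels : ∀ {m} {P R : SetPartition m} → Chain P R → List ℕ
labels done = []
labels (step Q a b _ _ _ _ c) = suc (toℕ b) ∷ labels c

Inv : List ℕ → List ℕ
Inv [] = []
Inv (x ∷ xs) = length (filter (λ y → y ≤? x) (x ∷ xs)) ∷ Inv xs

-- The label of a cover is the minimum of the block that stops being a block
-- minimum, so along a chain with label sequence σ the block minima just
-- before the i-th step are exactly 1, σ_i, …, σ_n.  The i-th step therefore
-- has to merge the block with minimum σ_i into a block with a smaller
-- minimum, i.e. one of 1 and the σ_j < σ_i with j > i: that is a_i choices,
-- each of which leaves the same situation for the remaining labels.

module Submission where

open import Defs
open import Data.Nat using (ℕ; _≤_; _+_)
open import Data.Nat.ListAction using (product)
open import Data.Fin using (Fin)
open import Data.List using (List; map; upTo)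
open import Data.List.Relation.Binary.Permutation.Propositional using (_↭_)
open import Data.Product using (Σ)
open import Relation.Binary.PropositionalEquality using (_≡_)
open import Function.Bundles using (_↔_)

open import Data.Bool using (Bool; true; false; _∧_; _∨_; if_then_else_)
open import Data.Bool.Properties using (∧-comm; ∧-distribʳ-∨)
open import Data.Empty using (⊥)
open import Data.Fin using (zero; suc; toℕ; fromℕ<; _<_)
open import Data.Fin.Properties
  using (_≟_; _<?_; <-irrelevant; toℕ-injective; toℕ<n; toℕ-fromℕ<; +↔⊎; *↔×)
open import Data.List using ([]; _∷_; length; filter)
open import Data.List.Properties using (∷-injectiveˡ; ∷-injectiveʳ; filter-accept; filter-reject)
import Data.List.Relation.Unary.All as All
open import Data.List.Relation.Unary.All using (All; []; _∷_)
import Data.List.Relation.Unary.All.Properties as All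
open import Data.List.Relation.Unary.All.Properties using (all-upTo)
open import Data.List.Relation.Unary.Any using (here; there)
open import Data.List.Relation.Unary.Unique.Propositional using (Unique; []; _∷_)
import Data.List.Relation.Unary.Unique.Propositional.Properties as Unique
open import Data.List.Relation.Binary.Permutation.Propositional using (↭-sym; ↭-prep; ↭⇒↭ₛ)
open import Data.List.Relation.Binary.Permutation.Propositional.Properties using (All-resp-↭; ∈-resp-↭)
open import Data.List.Membership.Propositional.Properties using (∈-map⁺; ∈-upTo⁺)
open import Data.Nat using (zero; suc)
import Data.Nat.Properties as ℕ
open import Data.Nat.Properties using (_≤?_)
open import Data.List.Membership.DecPropositional ℕ._≟_ using (_∈_; _∈?_)
open import Data.Product using (_×_; _,_; proj₁)
open import Data.Product.Function.Dependent.Propositional using (Σ-↔)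
open import Data.Product.Function.NonDependent.Propositional using (_×-⇔_; _×-↔_)
open import Data.Sum using (_⊎_; inj₁; inj₂)
open import Data.Sum.Function.Propositional using (_⊎-↔_)
open import Data.Vec using (lookup; tabulate)
import Data.Vec as Vec
open import Data.Vec.Properties
  using (lookup-map; lookup∘tabulate; tabulate∘lookup; tabulate-cong; tabulate-∘; map-const)
open import Function using (_∘_; id; const)
open import Function.Bundles using (_⇔_; mk⇔; mk↔ₛ′; Equivalence)
open import Function.Properties.Equivalence using () renaming (trans to ⇔-trans)
open import Function.Properties.Inverse using (↔-refl)
open import Function.Related.Propositional using (module EquationalReasoning)
open import Relation.Binary.PropositionalEquality
  using (refl; sym; trans; cong; cong₂; subst; _≢_; module ≡-Reasoning)
open import Relation.Binary.PropositionalEquality.Properties using (setoid)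
open import Data.List.Relation.Binary.Permutation.Setoid.Properties (setoid ℕ) using (Unique-resp-↭)
open import Relation.Binary.PropositionalEquality.WithK using (≡-irrelevant)
open import Relation.Nullary using (¬_; Dec; Irrelevant; yes; no; does; contradiction)
open import Relation.Nullary.Decidable using (does-⇔; dec-true; dec-false; _×-dec_)
open import Relation.Unary using (Pred; Decidable)

𝟙 : Bool → ℕ
𝟙 b = if b then 1 else 0

count : ∀ {m} → (Fin m → Bool) → ℕ
count {zero}  f = 0
count {suc m} f = 𝟙 (f zero) + count (f ∘ suc)

count-cong : ∀ {m} {f g : Fin m → Bool} → (∀ a → f a ≡ g a) → count f ≡ count g
count-cong {zero}  f≗g = refl
count-cong {suc m} f≗g = cong₂ _+_ (cong 𝟙 (f≗g zero)) (count-cong (f≗g ∘ suc))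

count-false : ∀ {m} {f : Fin m → Bool} → (∀ a → f a ≡ false) → count f ≡ 0
count-false {zero}  f≡false = refl
count-false {suc m} f≡false rewrite f≡false zero = count-false (f≡false ∘ suc)

count-∨ : ∀ {m p q} {P : Pred (Fin m) p} {Q : Pred (Fin m) q} (P? : Decidable P) (Q? : Decidable Q) →
          (∀ a → P a → Q a → ⊥) →
          count (λ a → does (P? a) ∨ does (Q? a)) ≡ count (does ∘ P?) + count (does ∘ Q?)
count-∨ {zero} P? Q? disjoint = refl
count-∨ {suc m} P? Q? disjoint
  with P? zero | Q? zero | count-∨ (P? ∘ suc) (Q? ∘ suc) (disjoint ∘ suc)
... | yes p | yes q | _  = contradiction q (disjoint zero p)
... | yes _ | no _  | ih = cong suc ih
... | no _  | yes _ | ih = trans (cong suc ih) (sym (ℕ.+-suc _ _))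
... | no _  | no _  | ih = ih

Σ-Fin-suc↔ : ∀ {m p} (P : Fin (suc m) → Set p) → Σ (Fin (suc m)) P ↔ (P zero ⊎ Σ (Fin m) (P ∘ suc))
Σ-Fin-suc↔ P = mk↔ₛ′
  (λ { (zero , p) → inj₁ p ; (suc a , p) → inj₂ (a , p) })
  (λ { (inj₁ p) → zero , p ; (inj₂ (a , p)) → suc a , p })
  (λ { (inj₁ p) → refl ; (inj₂ (a , p)) → refl })
  (λ { (zero , p) → refl ; (suc a , p) → refl })

Dec↔Fin-𝟙 : ∀ {p} {A : Set p} (a? : Dec A) → Irrelevant A → A ↔ Fin (𝟙 (does a?))
Dec↔Fin-𝟙 (yes a) irr = mk↔ₛ′ (λ _ → zero) (λ _ → a) (λ { zero → refl }) (λ _ → irr _ _)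
Dec↔Fin-𝟙 (no ¬a) irr = mk↔ₛ′ (λ a → contradiction a ¬a) (λ ()) (λ ()) (λ a → contradiction a ¬a)

Σ-Fin↔Fin-count : ∀ {m p} {P : Pred (Fin m) p} (P? : Decidable P) → (∀ {a} → Irrelevant (P a)) →
                  Σ (Fin m) P ↔ Fin (count (does ∘ P?))
Σ-Fin↔Fin-count {zero} P? irr = mk↔ₛ′ (λ ()) (λ ()) (λ ()) (λ ())
Σ-Fin↔Fin-count {suc m} {P = P} P? irr = begin
  Σ (Fin (suc m)) P                ↔⟨ Σ-Fin-suc↔ P ⟩
  (P zero ⊎ Σ (Fin m) (P ∘ suc))   ↔⟨ Dec↔Fin-𝟙 (P? zero) irr ⊎-↔ Σ-Fin↔Fin-count (P? ∘ suc) irr ⟩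
  (Fin _ ⊎ Fin _)                  ↔⟨ +↔⊎ ⟨
  Fin (count (does ∘ P?))          ∎
  where open EquationalReasoning

⌜_⌝ : ∀ {m} → Fin m → ℕ
⌜ a ⌝ = suc (toℕ a)

⌜⌝-injective : ∀ {m} {a b : Fin m} → ⌜ a ⌝ ≡ ⌜ b ⌝ → a ≡ b
⌜⌝-injective = toℕ-injective ∘ ℕ.suc-injective

InRange : ℕ → ℕ → Set
InRange m y = Σ (Fin m) (λ a → y ≡ ⌜ a ⌝)

count-single : ∀ {m} (a₀ : Fin m) (g : Fin m → Bool) →
               count (λ a → does (⌜ a ⌝ ℕ.≟ ⌜ a₀ ⌝) ∧ g a) ≡ 𝟙 (g a₀)
count-single {suc m} zero g = trans (cong (𝟙 (g zero) +_) (count-false {m} (λ _ → refl))) (ℕ.+-identityʳ _)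
count-single (suc a₀)     g = count-single a₀ (g ∘ suc)

length-filter-∷ : ∀ {a p} {A : Set a} {Q : Pred A p} (Q? : Decidable Q) y ys →
                  length (filter Q? (y ∷ ys)) ≡ 𝟙 (does (Q? y)) + length (filter Q? ys)
length-filter-∷ Q? y ys with does (Q? y)
... | true  = refl
... | false = refl

count-∈ : ∀ {m p} {Q : Pred ℕ p} (Q? : Decidable Q) {ρ : List ℕ} → All (InRange m) ρ → Unique ρ →
          count (λ (a : Fin m) → does (⌜ a ⌝ ∈? ρ) ∧ does (Q? ⌜ a ⌝)) ≡ length (filter Q? ρ)
count-∈ {m} Q? {[]} [] [] = count-false {m} (λ _ → refl)
count-∈ {m} Q? {_ ∷ ρ} ((a₀ , refl) ∷ inRange) (a₀∉ρ ∷ distinct) = begin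
  count (λ a → does (⌜ a ⌝ ∈? ⌜ a₀ ⌝ ∷ ρ) ∧ q a)
    ≡⟨ count-cong (λ a → ∧-distribʳ-∨ (q a) (does (⌜ a ⌝ ℕ.≟ ⌜ a₀ ⌝)) (does (⌜ a ⌝ ∈? ρ))) ⟩
  count (λ a → (does (⌜ a ⌝ ℕ.≟ ⌜ a₀ ⌝) ∧ q a) ∨ (does (⌜ a ⌝ ∈? ρ) ∧ q a))
    ≡⟨ count-∨ {m} (λ a → (⌜ a ⌝ ℕ.≟ ⌜ a₀ ⌝) ×-dec Q? ⌜ a ⌝) (λ a → (⌜ a ⌝ ∈? ρ) ×-dec Q? ⌜ a ⌝)
               (λ { a (a≡a₀ , _) (a∈ρ , _) → All.lookup a₀∉ρ a∈ρ (sym a≡a₀) }) ⟩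
  count (λ a → does (⌜ a ⌝ ℕ.≟ ⌜ a₀ ⌝) ∧ q a) + count (λ a → does (⌜ a ⌝ ∈? ρ) ∧ q a)
    ≡⟨ cong₂ _+_ (count-single a₀ q) (count-∈ Q? inRange distinct) ⟩
  𝟙 (does (Q? ⌜ a₀ ⌝)) + length (filter Q? ρ)
    ≡⟨ length-filter-∷ Q? ⌜ a₀ ⌝ ρ ⟨
  length (filter Q? (⌜ a₀ ⌝ ∷ ρ)) ∎
  where
  open ≡-Reasoning
  q : Fin m → Bool
  q a = does (Q? ⌜ a ⌝)

filter-≤?-suc : ∀ {k} {xs : List ℕ} → All (suc k ≢_) xs → filter (_≤? k) xs ≡ filter (_≤? suc k) xs
filter-≤?-suc [] = refl
filter-≤?-suc {k} {y ∷ xs} (k+1≢y ∷ k+1∉xs) with y ≤? k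
... | yes y≤k = begin
  filter (_≤? k) (y ∷ xs)       ≡⟨ filter-accept (_≤? k) y≤k ⟩
  y ∷ filter (_≤? k) xs         ≡⟨ cong (y ∷_) (filter-≤?-suc k+1∉xs) ⟩
  y ∷ filter (_≤? suc k) xs     ≡⟨ filter-accept (_≤? suc k) (ℕ.m≤n⇒m≤1+n y≤k) ⟨
  filter (_≤? suc k) (y ∷ xs)   ∎
  where open ≡-Reasoning
... | no y≰k = begin
  filter (_≤? k) (y ∷ xs)       ≡⟨ filter-reject (_≤? k) y≰k ⟩
  filter (_≤? k) xs             ≡⟨ filter-≤?-suc k+1∉xs ⟩
  filter (_≤? suc k) xs         ≡⟨ filter-reject (_≤? suc k) y≰k+1 ⟨
  filter (_≤? suc k) (y ∷ xs)   ∎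
  where
  open ≡-Reasoning
  y≰k+1 : ¬ y ≤ suc k
  y≰k+1 y≤k+1 = y≰k (ℕ.≤-pred (ℕ.≤∧≢⇒< y≤k+1 (k+1≢y ∘ sym)))

∈-drop-second⇔ : ∀ {w c y : ℕ} {τ} → Unique (w ∷ c ∷ τ) → (y ∈ w ∷ c ∷ τ × y ≢ c) ⇔ y ∈ w ∷ τ
∈-drop-second⇔ ((w≢c ∷ _) ∷ (c∉τ ∷ _)) = mk⇔
  (λ { (here y≡w , _) → here y≡w
     ; (there (here y≡c) , y≢c) → contradiction y≡c y≢c
     ; (there (there y∈τ) , _) → there y∈τ })
  (λ { (here refl) → here refl , w≢c
     ; (there y∈τ) → there (there y∈τ) , λ { refl → All.lookup c∉τ y∈τ refl } })

Idempotent : ∀ {m} → SetPartition m → Set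
Idempotent P = ∀ x → lookup P (lookup P x) ≡ lookup P x

BlockMinimaBelow : ∀ {m} → SetPartition m → Fin m → Set
BlockMinimaBelow {m} P b = Σ (Fin m) (λ a → a < b × lookup P a ≡ a)

module _ {m} {P : SetPartition m} {a b : Fin m} where

  merge-absorbs : ∀ {x} → lookup P x ≡ b → lookup (merge P a b) x ≡ a
  merge-absorbs {x} Px≡b =
    trans (lookup-map x _ P) (cong (λ d → if d then a else lookup P x) (dec-true (lookup P x ≟ b) Px≡b))

  merge-keeps : ∀ {x} → lookup P x ≢ b → lookup (merge P a b) x ≡ lookup P x
  merge-keeps {x} Px≢b =
    trans (lookup-map x _ P) (cong (λ d → if d then a else lookup P x) (dec-false (lookup P x ≟ b) Px≢b))

  merge-idempotent : Idempotent P → lookup P a ≡ a → a ≢ b → Idempotent (merge P a b)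
  merge-idempotent idempotent Pa≡a a≢b x with lookup P x ≟ b
  ... | yes Px≡b = begin
    Q (Q x)     ≡⟨ cong Q (merge-absorbs Px≡b) ⟩
    Q a         ≡⟨ merge-keeps (a≢b ∘ trans (sym Pa≡a)) ⟩
    lookup P a  ≡⟨ Pa≡a ⟩
    a           ≡⟨ merge-absorbs Px≡b ⟨
    Q x         ∎
    where
    open ≡-Reasoning
    Q = lookup (merge P a b)
  ... | no Px≢b = begin
    Q (Q x)                ≡⟨ cong Q (merge-keeps Px≢b) ⟩
    Q (lookup P x)         ≡⟨ merge-keeps (Px≢b ∘ trans (sym (idempotent x))) ⟩
    lookup P (lookup P x)  ≡⟨ idempotent x ⟩
    lookup P x             ≡⟨ merge-keeps Px≢b ⟨
    Q x                    ∎
    where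
    open ≡-Reasoning
    Q = lookup (merge P a b)

  merge-fixed⇔ : lookup P a ≡ a → a ≢ b → ∀ x → lookup (merge P a b) x ≡ x ⇔ (lookup P x ≡ x × x ≢ b)
  merge-fixed⇔ Pa≡a a≢b x with lookup P x ≟ b
  ... | yes Px≡b = mk⇔ (λ Qx≡x → contradiction (b≡a Qx≡x) (a≢b ∘ sym))
                       (λ (Px≡x , x≢b) → contradiction (trans (sym Px≡x) Px≡b) x≢b)
    where
    b≡a : lookup (merge P a b) x ≡ x → b ≡ a
    b≡a Qx≡x = begin
      b          ≡⟨ Px≡b ⟨
      lookup P x ≡⟨ cong (lookup P) (trans (sym Qx≡x) (merge-absorbs Px≡b)) ⟩
      lookup P a ≡⟨ Pa≡a ⟩
      a          ∎
      where open ≡-Reasoning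
  ... | no Px≢b = mk⇔ (λ Qx≡x → let Px≡x = trans (sym (merge-keeps Px≢b)) Qx≡x in
                                 Px≡x , Px≢b ∘ trans Px≡x)
                      (λ (Px≡x , _) → trans (merge-keeps Px≢b) Px≡x)

-- The state of a chain that has reached P and still has to produce the labels τ.
record Compatible {m} (P : SetPartition m) (τ : List ℕ) : Set where
  field
    idempotent : Idempotent P
    minima     : ∀ x → lookup P x ≡ x ⇔ ⌜ x ⌝ ∈ 1 ∷ τ
    inRange    : All (InRange m) τ
    distinct   : Unique (1 ∷ τ)

module _ {n} {P : SetPartition (suc n)} {b : Fin (suc n)} {τ : List ℕ} (c : Compatible P (⌜ b ⌝ ∷ τ)) where
  open Compatible c

  label-is-minimum : lookup P b ≡ b
  label-is-minimum = Equivalence.from (minima b) (there (here refl))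

  compatible-merge : ∀ {a} → a < b → lookup P a ≡ a → Compatible (merge P a b) τ
  compatible-merge {a} a<b Pa≡a = record
    { idempotent = merge-idempotent {P = P} idempotent Pa≡a a≢b
    ; minima     = λ x → ⇔-trans (merge-fixed⇔ {P = P} Pa≡a a≢b x)
                                 (⇔-trans (minima x ×-⇔ ≢⇔⌜⌝≢) (∈-drop-second⇔ distinct))
    ; inRange    = All.tail inRange
    ; distinct   = drop-second distinct
    }
    where
    a≢b : a ≢ b
    a≢b a≡b = ℕ.<-irrefl (cong toℕ a≡b) a<b
    ≢⇔⌜⌝≢ : ∀ {x} → x ≢ b ⇔ ⌜ x ⌝ ≢ ⌜ b ⌝
    ≢⇔⌜⌝≢ = mk⇔ (λ x≢b → x≢b ∘ ⌜⌝-injective) (λ ⌜x⌝≢⌜b⌝ → ⌜x⌝≢⌜b⌝ ∘ cong ⌜_⌝)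
    drop-second : Unique (1 ∷ ⌜ b ⌝ ∷ τ) → Unique (1 ∷ τ)
    drop-second ((_ ∷ 1∉τ) ∷ (_ ∷ τ-distinct)) = 1∉τ ∷ τ-distinct

  count-minima-below : count (λ a → does ((a <? b) ×-dec (lookup P a ≟ a)))
                       ≡ length (filter (_≤? ⌜ b ⌝) (⌜ b ⌝ ∷ τ))
  count-minima-below = begin
    count (λ a → does (a <? b) ∧ does (lookup P a ≟ a))
      ≡⟨ count-cong (λ a → trans (cong (does (a <? b) ∧_) (is-minimum a)) (∧-comm (does (a <? b)) _)) ⟩
    count {suc n} (λ a → does (⌜ a ⌝ ∈? 1 ∷ ⌜ b ⌝ ∷ τ) ∧ does (⌜ a ⌝ ≤? toℕ b))
      ≡⟨ count-∈ (_≤? toℕ b) ((zero , refl) ∷ inRange) distinct ⟩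
    length (filter (_≤? toℕ b) (1 ∷ ⌜ b ⌝ ∷ τ))
      ≡⟨ cong length (filter-accept (_≤? toℕ b) 1≤b) ⟩
    suc (length (filter (_≤? toℕ b) (⌜ b ⌝ ∷ τ)))
      ≡⟨ cong (suc ∘ length) (filter-reject (_≤? toℕ b) (ℕ.n≮n (toℕ b))) ⟩
    suc (length (filter (_≤? toℕ b) τ))
      ≡⟨ cong (suc ∘ length) (filter-≤?-suc b∉τ) ⟩
    suc (length (filter (_≤? ⌜ b ⌝) τ))
      ≡⟨ cong length (filter-accept (_≤? ⌜ b ⌝) ℕ.≤-refl) ⟨
    length (filter (_≤? ⌜ b ⌝) (⌜ b ⌝ ∷ τ)) ∎
    where
    open ≡-Reasoning
    is-minimum : ∀ a → does (lookup P a ≟ a) ≡ does (⌜ a ⌝ ∈? 1 ∷ ⌜ b ⌝ ∷ τ)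
    is-minimum a = does-⇔ (minima a) (lookup P a ≟ a) (⌜ a ⌝ ∈? 1 ∷ ⌜ b ⌝ ∷ τ)
    1≤b : 1 ≤ toℕ b
    1≤b with (1≢⌜b⌝ ∷ _) ∷ _ ← distinct = ℕ.n≢0⇒n>0 (1≢⌜b⌝ ∘ cong suc ∘ sym)
    b∉τ : All (⌜ b ⌝ ≢_) τ
    b∉τ with _ ∷ (⌜b⌝∉τ ∷ _) ← distinct = ⌜b⌝∉τ

  blockMinimaBelow↔ : BlockMinimaBelow P b ↔ Fin (length (filter (_≤? ⌜ b ⌝) (⌜ b ⌝ ∷ τ)))
  blockMinimaBelow↔ = subst (λ k → _ ↔ Fin k) count-minima-below
    (Σ-Fin↔Fin-count (λ a → (a <? b) ×-dec (lookup P a ≟ a))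
                     (λ (p , q) (p′ , q′) → cong₂ _,_ (<-irrelevant p p′) (≡-irrelevant q q′)))

compatible-[]⇒top : ∀ {n} {P : SetPartition (suc n)} → Compatible P [] → P ≡ top n
compatible-[]⇒top {n} {P} c = begin
  P                                    ≡⟨ tabulate∘lookup P ⟨
  tabulate (lookup P)                  ≡⟨ tabulate-cong lookup≡zero ⟩
  tabulate (const zero ∘ id)           ≡⟨ tabulate-∘ (const zero) id ⟩
  Vec.map (const zero) (tabulate id)   ≡⟨ map-const (tabulate id) _ ⟩
  top n                                ∎
  where
  open ≡-Reasoning
  open Compatible c
  lookup≡zero : ∀ x → lookup P x ≡ zero
  lookup≡zero x with Equivalence.to (minima (lookup P x)) (idempotent x)
  ... | here ⌜Px⌝≡1 = ⌜⌝-injective ⌜Px⌝≡1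

compatible-bottom : ∀ {n σ} → σ ↭ map (2 +_) (upTo n) → Compatible (bottom (suc n)) σ
compatible-bottom {n} {σ} σ↭ = record
  { idempotent = λ x → cong (lookup (bottom (suc n))) (lookup∘tabulate id x)
  ; minima     = λ x → mk⇔ (λ _ → ∈-1∷σ x) (λ _ → lookup∘tabulate id x)
  ; inRange    = All-resp-↭ (↭-sym σ↭) (All.map⁺ (All.map inRange-2+ (all-upTo n)))
  ; distinct   = Unique-resp-↭ (↭⇒↭ₛ (↭-prep 1 (↭-sym σ↭)))
                   (All.map⁺ (All.universal (λ _ ()) _) ∷ Unique.map⁺ (ℕ.+-cancelˡ-≡ 2 _ _) (Unique.upTo⁺ n))
  }
  where
  ∈-1∷σ : ∀ x → ⌜ x ⌝ ∈ 1 ∷ σ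
  ∈-1∷σ zero    = here refl
  ∈-1∷σ (suc i) = there (∈-resp-↭ (↭-sym σ↭) (∈-map⁺ (2 +_) (∈-upTo⁺ (toℕ<n i))))
  inRange-2+ : ∀ {k} → k Data.Nat.< n → InRange (suc n) (2 + k)
  inRange-2+ k<n = suc (fromℕ< k<n) , cong (2 +_) (sym (toℕ-fromℕ< k<n))

LabelledChains : ∀ {m} → SetPartition m → SetPartition m → List ℕ → Set
LabelledChains P R τ = Σ (Chain P R) (λ F → labels F ≡ τ)

chains-[]↔ : ∀ {m} {P R : SetPartition m} → P ≡ R → LabelledChains P R [] ↔ Fin 1
chains-[]↔ refl = mk↔ₛ′ (λ _ → zero) (λ _ → done , refl) (λ { zero → refl })
                         (λ { (done , refl) → refl ; (step _ _ _ _ _ _ _ _ , ()) })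

module _ {m} {P R : SetPartition m} {b : Fin m} {τ : List ℕ} (Pb≡b : lookup P b ≡ b) where

  chains-∷↔ : LabelledChains P R (⌜ b ⌝ ∷ τ) ↔
              Σ (BlockMinimaBelow P b) (λ x → LabelledChains (merge P (proj₁ x) b) R τ)
  chains-∷↔ = mk↔ₛ′ to from to∘from from∘to
    where
    to : LabelledChains P R (⌜ b ⌝ ∷ τ) →
         Σ (BlockMinimaBelow P b) (λ x → LabelledChains (merge P (proj₁ x) b) R τ)
    to (step _ a b′ a<b′ Pa≡a _ refl F , eq) with refl ← ⌜⌝-injective (∷-injectiveˡ eq) =
      (a , a<b′ , Pa≡a) , F , ∷-injectiveʳ eq

    from : Σ (BlockMinimaBelow P b) (λ x → LabelledChains (merge P (proj₁ x) b) R τ) →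
           LabelledChains P R (⌜ b ⌝ ∷ τ)
    from ((a , a<b , Pa≡a) , F , eq) = step _ a b a<b Pa≡a Pb≡b refl F , cong (⌜ b ⌝ ∷_) eq

    to∘from : ∀ x → to (from x) ≡ x
    to∘from ((a , a<b , Pa≡a) , F , eq) with refl ← ⌜⌝-injective (∷-injectiveˡ (cong (⌜ b ⌝ ∷_) eq)) =
      cong (λ eq′ → (a , a<b , Pa≡a) , F , eq′) (≡-irrelevant _ _)

    from∘to : ∀ x → from (to x) ≡ x
    from∘to (step _ a b′ a<b′ Pa≡a Pb′≡b′ refl F , eq) with refl ← ⌜⌝-injective (∷-injectiveˡ eq) =
      cong₂ (λ Pb≡b′ eq′ → step _ a b a<b′ Pa≡a Pb≡b′ refl F , eq′) (≡-irrelevant _ _) (≡-irrelevant _ _)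

labelledChains↔ : ∀ {n} {P : SetPartition (suc n)} τ → Compatible P τ →
                  LabelledChains P (top n) τ ↔ Fin (product (Inv τ))
labelledChains↔ [] c = chains-[]↔ (compatible-[]⇒top c)
labelledChains↔ {n} {P} (_ ∷ τ) c with (b , refl) ∷ _ ← Compatible.inRange c = begin
  LabelledChains P (top n) (⌜ b ⌝ ∷ τ)
    ↔⟨ chains-∷↔ (label-is-minimum c) ⟩
  Σ (BlockMinimaBelow P b) (λ x → LabelledChains (merge P (proj₁ x) b) (top n) τ)
    ↔⟨ Σ-↔ ↔-refl (λ { {a , a<b , Pa≡a} → labelledChains↔ τ (compatible-merge c a<b Pa≡a) }) ⟩
  (BlockMinimaBelow P b × Fin (product (Inv τ)))
    ↔⟨ blockMinimaBelow↔ c ×-↔ ↔-refl ⟩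
  (Fin (length (filter (_≤? ⌜ b ⌝) (⌜ b ⌝ ∷ τ))) × Fin (product (Inv τ)))
    ↔⟨ *↔× ⟨
  Fin (product (Inv (⌜ b ⌝ ∷ τ))) ∎
  where open EquationalReasoning

proposition3p5 : (n : ℕ) → 1 ≤ n → (σ : List ℕ) → σ ↭ map (λ k → 2 + k) (upTo n) →
    Σ (MaxChain n) (λ F → labels F ≡ σ) ↔ Fin (product (Inv σ))
proposition3p5 n _ σ σ↭ = labelledChains↔ σ (compatible-bottom σ↭)
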